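{- Let $H$ be a connected $4$-uniform hypergraph of order $8$, and let $n_1$ be the number of unordered pairs of distinct vertices at distance $1$ in $H$. Then $n_1\ge 15$, and equality $n_1=15$ can only hold if $H$ has exactly $3$ hyperedges.
   Context: A hypergraph $H=(V,E)$ consists of a finite vertex set $V$ and a set $E$ of distinct subsets of $V$ (hyperedges); it is $4$-uniform if every hyperedge has exactly $4$ elements; its order is $|V|$. For $u,w\in V$, $d_H(u,w)$ is the least $\ell\ge0$ such that there are vertices $u=x_0,\dots,x_\ell=w$ with $x_{i-1},x_i$ in a common hyperedge for each $i$ ($\infty$ if none); $H$ is connected if all distances are finite. Two distinct vertices are at distance $1$ iff they lie in a common hyperedge. -}

module Defs where

open import Data.Nat using (ℕ)
open import Data.Fin using (Fin; _<_; _<?_)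
open import Data.Fin.Subset using (Subset; _∈_; ∣_∣)
open import Data.Fin.Subset.Properties using (_∈?_)
open import Data.List using (List; length; filter; allFin; cartesianProduct)
open import Data.List.Relation.Unary.Any using (Any; any?)
open import Data.List.Relation.Unary.All using (All)
open import Data.List.Relation.Unary.Unique.Propositional using (Unique)
open import Data.Product using (_×_; _,_; proj₁; proj₂)
open import Relation.Nullary using (Dec)
open import Relation.Nullary.Decidable using (_×-dec_)
open import Relation.Binary.PropositionalEquality using (_≡_)
open import Relation.Binary.Construct.Closure.ReflexiveTransitive using (Star)

record Hypergraph (n : ℕ) : Set where
  field
    edges    : List (Subset n)
    distinct : Unique edges
open Hypergraph public

Uniform : ∀ {n} → ℕ → Hypergraph n → Set
Uniform k H = All (λ e → ∣ e ∣ ≡ k) (edges H)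

CommonEdge : ∀ {n} → Hypergraph n → Fin n → Fin n → Set
CommonEdge H u w = Any (λ e → (u ∈ e) × (w ∈ e)) (edges H)

commonEdge? : ∀ {n} (H : Hypergraph n) (u w : Fin n) → Dec (CommonEdge H u w)
commonEdge? H u w = any? (λ e → (u ∈? e) ×-dec (w ∈? e)) (edges H)

Connected : ∀ {n} → Hypergraph n → Set
Connected {n} H = (u w : Fin n) → Star (CommonEdge H) u w

-- unordered pairs {u,w} of distinct vertices at distance 1, represented
-- as ordered pairs with u < w
DistOne : ∀ {n} → Hypergraph n → Fin n × Fin n → Set
DistOne H p = (proj₁ p < proj₂ p) × CommonEdge H (proj₁ p) (proj₂ p)

distOne? : ∀ {n} (H : Hypergraph n) (p : Fin n × Fin n) → Dec (DistOne H p)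
distOne? H (u , w) = (u <? w) ×-dec commonEdge? H u w

n₁ : ∀ {n} → Hypergraph n → ℕ
n₁ {n} H = length (filter (distOne? H) (cartesianProduct (allFin n) (allFin n)))

numEdges : ∀ {n} → Hypergraph n → ℕ
numEdges H = length (edges H)

{-# OPTIONS --safe #-}
module Submission where

-- Grow a vertex set S from a single vertex, each time attaching an edge that meets S but is not
-- contained in S; connectivity provides one until S contains all 8 vertices.  An edge meeting S in
-- j ∈ {1,2,3} vertices brings gain j = 6 − C(j,2) distance-1 pairs not inside S, so
-- completionCost ∣S∣ + (number of distance-1 pairs inside S) does not decrease as S grows.  It is at
-- most n₁ once S contains all vertices, and it is 15 for a single vertex.
-- If n₁ = 15, a finite check on the first three meets shows that the first three edges e₁, e₂, e₃
-- already cover all vertices and that every distance-1 pair lies inside e₁, e₂ or e₃ (any other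
-- outcome costs at least 16).  Every edge has all its pairs at distance 1, so it lies inside one of
-- e₁, e₂, e₃ and, having 4 vertices, equals it.

open import Defs
open import Level using (Level)
open import Data.Nat using (ℕ; zero; suc; z<s; _+_; _∸_; _≤_; _<_; z≤n; s≤s; _≟_; _≤?_; _<?_)
open import Data.Nat.Properties
open import Data.Nat.Combinatorics using (_C_)
open import Data.Fin using (Fin; zero) renaming (_<_ to _<ᶠ_; _<?_ to _<ᶠ?_)
open import Data.Fin.Properties using (any?) renaming (<-cmp to <ᶠ-cmp)
open import Data.Fin.Subset using (Subset; _∈_; _∉_; _⊆_; ∣_∣; _∪_; _∩_; ∁; ⊤; ⁅_⁆; Nonempty; inside; outside)
open import Data.Fin.Subset.Properties
  using (_∈?_; nonempty?; Empty-unique; ∣⊥∣≡0; x∈p⇒∣p-x∣<∣p∣; ∣∁p∣≡n∸∣p∣; x∈∁p⇒x∉p; ⊆-antisym; p⊂q⇒∣p∣<∣q∣;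
         ∣p∣≤n; ∣p∣≡n⇒p≡⊤; p⊆q⇒∣p∣≤∣q∣; ⊆⊤; p∩q⊆p; p∩q⊆q; p⊆p∪q; q⊆p∪q; x∈p∪q⁻; x∈p∩q⁺; x∈p∩q⁻; x∈⁅x⁆; anySubset?)
open import Data.Vec using ([]; _∷_)
open import Data.List using (List; []; _∷_; length; filter; allFin; cartesianProduct)
open import Data.List.Properties using (filter-some; length-removeAt′)
open import Data.List.Relation.Unary.All as All using (All; []; _∷_)
open import Data.List.Relation.Unary.Any using (here; there; index; _─_)
open import Data.List.Relation.Unary.AllPairs using ([]; _∷_)
open import Data.List.Relation.Unary.Unique.Propositional using (Unique)
open import Data.List.Membership.Propositional using (find; lose) renaming (_∈_ to _∈ₗ_)
open import Data.List.Membership.Propositional.Properties using (∈-cartesianProduct⁺; ∈-allFin)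
open import Data.List.Relation.Binary.Sublist.Propositional using (⊆-refl)
open import Data.List.Relation.Binary.Sublist.Propositional.Properties using (filter⁺; length-mono-≤)
open import Data.Product using (_×_; _,_; proj₁; proj₂; ∃; ∃₂; swap)
open import Data.Sum using (_⊎_; inj₁; inj₂)
import Data.Sum as Sum
open import Function using (_∘_)
open import Data.Nat.Tactic.RingSolver using (solve-∀)
open import Relation.Binary.Definitions using (tri<; tri≈; tri>)
open import Relation.Binary.PropositionalEquality using (_≡_; _≢_; refl; sym; trans; cong; subst; ≢-sym; module ≡-Reasoning)
open import Relation.Binary.Construct.Closure.ReflexiveTransitive using (Star; ε; _◅_)
open import Relation.Nullary using (¬_; yes; no; ¬?; contradiction)
open import Relation.Nullary.Decidable using (_×-dec_; _→-dec_; toWitness; toWitnessFalse; decidable-stable)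
open import Relation.Unary using (Pred; Decidable; _≐_) renaming (_⊆_ to _⇒_; _∩_ to _∧_)
open import Relation.Unary.Properties using (_∩?_; ∁?)

private
  variable
    a p q : Level
    A : Set a
    n : ℕ

module _ {P : Pred A p} {Q : Pred A q} (P? : Decidable P) (Q? : Decidable Q) where

  length-filter-split : ∀ xs →
    length (filter P? xs) ≡ length (filter (P? ∩? Q?) xs) + length (filter (P? ∩? ∁? Q?) xs)
  length-filter-split [] = refl
  length-filter-split (x ∷ xs) with P? x | Q? x
  ... | yes _ | yes _ = cong suc (length-filter-split xs)
  ... | yes _ | no _  = trans (cong suc (length-filter-split xs)) (sym (+-suc _ _))
  ... | no _  | yes _ = length-filter-split xs
  ... | no _  | no _  = length-filter-split xs

∈-─ : ∀ {x y : A} {ys} → x ∈ₗ ys → x ≢ y → (y∈ys : y ∈ₗ ys) → x ∈ₗ (ys ─ y∈ys)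
∈-─ (here refl)  x≢y (here refl) = contradiction refl x≢y
∈-─ (here refl)  x≢y (there _)   = here refl
∈-─ (there x∈ys) x≢y (here refl) = x∈ys
∈-─ (there x∈ys) x≢y (there y∈ys) = there (∈-─ x∈ys x≢y y∈ys)

Unique⇒length≤ : ∀ {xs ys : List A} → Unique xs → All (_∈ₗ ys) xs → length xs ≤ length ys
Unique⇒length≤ {xs = []} _ _ = z≤n
Unique⇒length≤ {xs = x ∷ xs} {ys} (x≢xs ∷ distinct-xs) (x∈ys ∷ xs⊆ys) = begin
  suc (length xs)              ≤⟨ s≤s (Unique⇒length≤ distinct-xs (All.zipWith xs⊆ys∖x (xs⊆ys , x≢xs))) ⟩
  suc (length (ys ─ x∈ys))     ≡⟨ length-removeAt′ ys (index x∈ys) ⟨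
  length ys                    ∎
  where
  open ≤-Reasoning
  xs⊆ys∖x : ∀ {z} → z ∈ₗ ys × x ≢ z → z ∈ₗ (ys ─ x∈ys)
  xs⊆ys∖x (z∈ys , x≢z) = ∈-─ z∈ys (≢-sym x≢z) x∈ys

Unique⇒length≡ : ∀ {xs ys : List A} → Unique xs → Unique ys → All (_∈ₗ ys) xs → All (_∈ₗ xs) ys →
                 length xs ≡ length ys
Unique⇒length≡ distinct-xs distinct-ys xs⊆ys ys⊆xs =
  ≤-antisym (Unique⇒length≤ distinct-xs xs⊆ys) (Unique⇒length≤ distinct-ys ys⊆xs)

Star-exit : ∀ {R : A → A → Set} {P : Pred A p} → Decidable P → ∀ {x y} → Star R x y → P x → ¬ P y →
            ∃₂ λ u w → P u × ¬ P w × R u w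
Star-exit P? ε Px ¬Py = contradiction Px ¬Py
Star-exit P? (_◅_ {j = z} r rs) Px ¬Py with P? z
... | yes Pz = Star-exit P? rs Pz ¬Py
... | no ¬Pz = _ , z , Px , ¬Pz , r

Nonempty⇒∣p∣>0 : {s : Subset n} → Nonempty s → 0 < ∣ s ∣
Nonempty⇒∣p∣>0 (x , x∈s) = ≤-trans (s≤s z≤n) (x∈p⇒∣p-x∣<∣p∣ x∈s)

∣p∣>0⇒Nonempty : (s : Subset n) → 0 < ∣ s ∣ → Nonempty s
∣p∣>0⇒Nonempty {n} s ∣s∣>0 with nonempty? s
... | yes ne = ne
... | no ¬ne = contradiction (trans (cong ∣_∣ (Empty-unique ¬ne)) (∣⊥∣≡0 n)) (>⇒≢ ∣s∣>0)

⊆∧∣p∣≡∣q∣⇒p≡q : {s t : Subset n} → s ⊆ t → ∣ s ∣ ≡ ∣ t ∣ → s ≡ t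
⊆∧∣p∣≡∣q∣⇒p≡q {s = s} s⊆t ∣s∣≡∣t∣ = ⊆-antisym s⊆t λ {x} x∈t →
  decidable-stable (x ∈? s) λ x∉s → <-irrefl ∣s∣≡∣t∣ (p⊂q⇒∣p∣<∣q∣ (s⊆t , x , x∈t , x∉s))

∣p∪q∣+∣p∩q∣≡∣p∣+∣q∣ : (s t : Subset n) → ∣ s ∪ t ∣ + ∣ s ∩ t ∣ ≡ ∣ s ∣ + ∣ t ∣
∣p∪q∣+∣p∩q∣≡∣p∣+∣q∣ [] [] = refl
∣p∪q∣+∣p∩q∣≡∣p∣+∣q∣ (inside ∷ s) (inside ∷ t) =
  cong suc (trans (+-suc _ _) (trans (cong suc (∣p∪q∣+∣p∩q∣≡∣p∣+∣q∣ s t)) (sym (+-suc _ _))))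
∣p∪q∣+∣p∩q∣≡∣p∣+∣q∣ (inside ∷ s) (outside ∷ t) = cong suc (∣p∪q∣+∣p∩q∣≡∣p∣+∣q∣ s t)
∣p∪q∣+∣p∩q∣≡∣p∣+∣q∣ (outside ∷ s) (inside ∷ t) = trans (cong suc (∣p∪q∣+∣p∩q∣≡∣p∣+∣q∣ s t)) (sym (+-suc _ _))
∣p∪q∣+∣p∩q∣≡∣p∣+∣q∣ (outside ∷ s) (outside ∷ t) = ∣p∪q∣+∣p∩q∣≡∣p∣+∣q∣ s t

⊆-∪⇒⊆⊎⊆ : {f s t : Subset n} → f ⊆ s ∪ t →
          (∀ {u w} → u ∈ f → w ∈ f → u ≢ w → (u ∈ s × w ∈ s) ⊎ (u ∈ t × w ∈ t)) →
          f ⊆ s ⊎ f ⊆ t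
⊆-∪⇒⊆⊎⊆ {f = f} {s} {t} f⊆s∪t together with any? (λ v → (v ∈? f) ×-dec ¬? (v ∈? s))
... | no ∄v = inj₁ λ {x} x∈f → decidable-stable (x ∈? s) λ x∉s → ∄v (x , x∈f , x∉s)
... | yes (v , v∈f , v∉s) = inj₂ λ {w} w∈f → decidable-stable (w ∈? t) (apart w∈f)
  where
  apart : ∀ {w} → w ∈ f → ¬ w ∉ t
  apart w∈f w∉t with x∈p∪q⁻ s t (f⊆s∪t w∈f)
  ... | inj₂ w∈t = w∉t w∈t
  ... | inj₁ w∈s with together v∈f w∈f (λ v≡w → v∉s (subst (_∈ s) (sym v≡w) w∈s))
  ...   | inj₁ (v∈s , _) = v∉s v∈s
  ...   | inj₂ (_ , w∈t) = w∉t w∈t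

module _ (H : Hypergraph n) where

  record CrossingEdge (S : Subset n) : Set where
    field
      edge   : Subset n
      edge∈H : edge ∈ₗ edges H
      meets  : Nonempty (S ∩ edge)
      leaves : ∃ λ b → b ∈ edge × b ∉ S

  crossingEdge : Connected H → {S : Subset n} → Nonempty S → ∣ S ∣ < n → CrossingEdge S
  crossingEdge connected {S} (v , v∈S) ∣S∣<n
    with u , u∈∁S ← ∣p∣>0⇒Nonempty (∁ S) (subst (0 <_) (sym (∣∁p∣≡n∸∣p∣ S)) (m<n⇒0<n∸m ∣S∣<n))
    with a , b , a∈S , b∉S , ab ← Star-exit (_∈? S) (connected v u) v∈S (x∈∁p⇒x∉p u∈∁S)
    with e , e∈H , a∈e , b∈e ← find ab
    = record { edge = e ; edge∈H = e∈H ; meets = a , x∈p∩q⁺ (a∈S , a∈e) ; leaves = b , b∈e , b∉S }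

  module _ {S : Subset n} (c : CrossingEdge S) where
    open CrossingEdge c

    ∣S∣<∣S∪edge∣ : ∣ S ∣ < ∣ S ∪ edge ∣
    ∣S∣<∣S∪edge∣ = let b , b∈e , b∉S = leaves in p⊂q⇒∣p∣<∣q∣ (p⊆p∪q edge , b , q⊆p∪q S edge b∈e , b∉S)

    ∣S∩edge∣<∣edge∣ : ∣ S ∩ edge ∣ < ∣ edge ∣
    ∣S∩edge∣<∣edge∣ = let b , b∈e , b∉S = leaves in
      p⊂q⇒∣p∣<∣q∣ ((λ x∈S∩e → proj₂ (x∈p∩q⁻ S edge x∈S∩e)) , b , b∈e , λ b∈S∩e → b∉S (proj₁ (x∈p∩q⁻ S edge b∈S∩e)))

    edge≢ : ∀ {X} → X ⊆ S → edge ≢ X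
    edge≢ X⊆S refl = let b , b∈e , b∉S = leaves in b∉S (X⊆S b∈e)

Pair : Set
Pair = Fin 8 × Fin 8

pairs : List Pair
pairs = cartesianProduct (allFin 8) (allFin 8)

count : {P : Pred Pair p} → Decidable P → ℕ
count P? = length (filter P? pairs)

count-mono : {P : Pred Pair p} {Q : Pred Pair q} (P? : Decidable P) (Q? : Decidable Q) → P ⇒ Q → count P? ≤ count Q?
count-mono P? Q? P⇒Q = length-mono-≤ (filter⁺ P? Q? (λ { refl → P⇒Q }) (⊆-refl {x = pairs}))

count-cong : {P : Pred Pair p} {Q : Pred Pair q} (P? : Decidable P) (Q? : Decidable Q) → P ≐ Q → count P? ≡ count Q?
count-cong P? Q? (P⇒Q , Q⇒P) = ≤-antisym (count-mono P? Q? P⇒Q) (count-mono Q? P? Q⇒P)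

count-split : {P : Pred Pair p} {Q : Pred Pair q} (P? : Decidable P) (Q? : Decidable Q) →
              count P? ≡ count (P? ∩? Q?) + count (P? ∩? ∁? Q?)
count-split P? Q? = length-filter-split P? Q? pairs

count-pos : {P : Pred Pair p} (P? : Decidable P) → ∀ {x} → P x → 0 < count P?
count-pos P? {u , w} Px = filter-some P? (lose (∈-cartesianProduct⁺ (∈-allFin u) (∈-allFin w)) Px)

Within : Subset 8 → Pred Pair _
Within X (u , w) = u <ᶠ w × u ∈ X × w ∈ X

within? : ∀ X → Decidable (Within X)
within? X (u , w) = (u <ᶠ? w) ×-dec (u ∈? X) ×-dec (w ∈? X)

Within-mono : ∀ {X Y} → X ⊆ Y → Within X ⇒ Within Y
Within-mono X⊆Y (u<w , u∈X , w∈X) = u<w , X⊆Y u∈X , X⊆Y w∈X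

count-Within : ∀ X → count (within? X) ≡ ∣ X ∣ C 2
count-Within X = decidable-stable (_ ≟ _) λ mismatch →
  toWitnessFalse {a? = anySubset? λ Y → ¬? (count (within? Y) ≟ ∣ Y ∣ C 2)} _ (X , mismatch)

newPairs : Subset 8 → Subset 8 → ℕ
newPairs S e = count (within? e ∩? ∁? (within? S))

newPairs≡ : ∀ S e → newPairs S e ≡ ∣ e ∣ C 2 ∸ ∣ S ∩ e ∣ C 2
newPairs≡ S e = trans (sym (m+n∸n≡m (newPairs S e) (∣ S ∩ e ∣ C 2))) (cong (_∸ ∣ S ∩ e ∣ C 2) new+old≡all)
  where
  open ≡-Reasoning
  old : count (within? e ∩? within? S) ≡ ∣ S ∩ e ∣ C 2
  old = trans (count-cong (within? e ∩? within? S) (within? (S ∩ e)) (both⇒∩ , ∩⇒both)) (count-Within (S ∩ e))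
    where
    both⇒∩ : Within e ∧ Within S ⇒ Within (S ∩ e)
    both⇒∩ ((u<w , u∈e , w∈e) , (_ , u∈S , w∈S)) = u<w , x∈p∩q⁺ (u∈S , u∈e) , x∈p∩q⁺ (w∈S , w∈e)
    ∩⇒both : Within (S ∩ e) ⇒ Within e ∧ Within S
    ∩⇒both within = Within-mono (p∩q⊆q S e) within , Within-mono (p∩q⊆p S e) within
  new+old≡all : newPairs S e + ∣ S ∩ e ∣ C 2 ≡ ∣ e ∣ C 2
  new+old≡all = begin
    newPairs S e + ∣ S ∩ e ∣ C 2                    ≡⟨ +-comm (newPairs S e) _ ⟩
    ∣ S ∩ e ∣ C 2 + newPairs S e                    ≡⟨ cong (_+ newPairs S e) old ⟨
    count (within? e ∩? within? S) + newPairs S e   ≡⟨ count-split (within? e) (within? S) ⟨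
    count (within? e)                               ≡⟨ count-Within e ⟩
    ∣ e ∣ C 2                                       ∎

grow : ℕ → ℕ → ℕ
grow k j = k + 4 ∸ j

gain : ℕ → ℕ
gain j = 4 C 2 ∸ j C 2

-- The least total gain of a sequence of steps k ↦ grow k j (1 ≤ j ≤ 3) leading from k to at least 8,
-- i.e. of attaching 4-sets, each meeting the current set in j points, until all 8 points are covered.
completionCost : ℕ → ℕ
completionCost 1 = 15
completionCost 2 = 12
completionCost 3 = 11
completionCost 4 = 9
completionCost 5 = 6
completionCost 6 = 5
completionCost 7 = 3
completionCost _ = 0

completionCost-grow : ∀ {k} → k < 9 → ∀ {j} → j < 4 → 1 ≤ j → completionCost k ≤ gain j + completionCost (grow k j)
completionCost-grow = toWitness {a? = allUpTo? (λ k → allUpTo? (λ j →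
  (1 ≤? j) →-dec (completionCost k ≤? gain j + completionCost (grow k j))) 4) 9} _

threeStepCost : ℕ → ℕ → ℕ → ℕ
threeStepCost j₁ j₂ j₃ = gain j₁ + gain j₂ + gain j₃ + completionCost (grow (grow (grow 1 j₁) j₂) j₃)

threeStepCost-bound : ∀ {j₁} → j₁ < 4 → ∀ {j₂} → j₂ < 4 → ∀ {j₃} → j₃ < 4 → 1 ≤ j₁ → 1 ≤ j₂ → 1 ≤ j₃ →
  15 ≤ threeStepCost j₁ j₂ j₃ × (grow (grow (grow 1 j₁) j₂) j₃ < 8 → 16 ≤ threeStepCost j₁ j₂ j₃)
threeStepCost-bound = toWitness {a? = allUpTo? (λ j₁ → allUpTo? (λ j₂ → allUpTo? (λ j₃ →
  (1 ≤? j₁) →-dec (1 ≤? j₂) →-dec (1 ≤? j₃) →-dec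
  ((15 ≤? threeStepCost j₁ j₂ j₃) ×-dec ((grow (grow (grow 1 j₁) j₂) j₃ <? 8) →-dec (16 ≤? threeStepCost j₁ j₂ j₃)))) 4) 4) 4} _

module FourUniform (H : Hypergraph 8) (uniform : Uniform 4 H) (connected : Connected H) where

  Adjacent : Pred Pair _
  Adjacent (u , w) = CommonEdge H u w

  adjacent? : Decidable Adjacent
  adjacent? (u , w) = commonEdge? H u w

  adjacentPairs : Subset 8 → ℕ
  adjacentPairs S = count (within? S ∩? adjacent?)

  adjacentPairs≤n₁ : ∀ S → adjacentPairs S ≤ n₁ H
  adjacentPairs≤n₁ S = count-mono (within? S ∩? adjacent?) (distOne? H) λ { {u , w} ((u<w , _) , adj) → u<w , adj }

  Stray : Subset 8 → Subset 8 → Pred Pair _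
  Stray S e p = ((Within (S ∪ e) p × Adjacent p) × ¬ Within S p) × ¬ Within e p

  stray? : ∀ S e → Decidable (Stray S e)
  stray? S e = ((within? (S ∪ e) ∩? adjacent?) ∩? ∁? (within? S)) ∩? ∁? (within? e)

  strayPairs : Subset 8 → Subset 8 → ℕ
  strayPairs S e = count (stray? S e)

  adjacentPairs-∪ : ∀ S {e} → e ∈ₗ edges H →
                    adjacentPairs S + newPairs S e + strayPairs S e ≤ adjacentPairs (S ∪ e)
  adjacentPairs-∪ S {e} e∈H = begin
    adjacentPairs S + newPairs S e + strayPairs S e                 ≡⟨ +-assoc (adjacentPairs S) _ _ ⟩
    adjacentPairs S + (newPairs S e + strayPairs S e)               ≤⟨ +-mono-≤ old (+-monoˡ-≤ (strayPairs S e) new) ⟩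
    count inS? + (count (outS? ∩? within? e) + strayPairs S e)      ≡⟨ cong (count inS? +_) (count-split outS? (within? e)) ⟨
    count inS? + count outS?                                        ≡⟨ count-split inS∪e? (within? S) ⟨
    adjacentPairs (S ∪ e)                                           ∎
    where
    open ≤-Reasoning
    inS∪e? : Decidable (Within (S ∪ e) ∧ Adjacent)
    inS∪e? = within? (S ∪ e) ∩? adjacent?
    inS? : Decidable ((Within (S ∪ e) ∧ Adjacent) ∧ Within S)
    inS? = inS∪e? ∩? within? S
    outS? : Decidable ((Within (S ∪ e) ∧ Adjacent) ∧ (¬_ ∘ Within S))
    outS? = inS∪e? ∩? ∁? (within? S)
    old : adjacentPairs S ≤ count inS?
    old = count-mono (within? S ∩? adjacent?) inS? λ (inS , adj) → (Within-mono (p⊆p∪q e) inS , adj) , inS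
    new : newPairs S e ≤ count (outS? ∩? within? e)
    new = count-mono (within? e ∩? ∁? (within? S)) (outS? ∩? within? e)
      λ { {u , w} (ine@(_ , u∈e , w∈e) , ∉S) → ((Within-mono (q⊆p∪q S e) ine , lose e∈H (u∈e , w∈e)) , ∉S) , ine }

  strayPairs≡0⇒⊆⊎⊆ : ∀ {S e f} → strayPairs S e ≡ 0 → f ∈ₗ edges H → f ⊆ S ∪ e → f ⊆ S ⊎ f ⊆ e
  strayPairs≡0⇒⊆⊎⊆ {S} {e} {f} none f∈H f⊆S∪e = ⊆-∪⇒⊆⊎⊆ f⊆S∪e together
    where
    together< : ∀ {u w} → u <ᶠ w → u ∈ f → w ∈ f → (u ∈ S × w ∈ S) ⊎ (u ∈ e × w ∈ e)
    together< {u} {w} u<w u∈f w∈f with within? S (u , w) | within? e (u , w)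
    ... | yes (_ , u∈S , w∈S) | _                   = inj₁ (u∈S , w∈S)
    ... | no _                | yes (_ , u∈e , w∈e) = inj₂ (u∈e , w∈e)
    ... | no ∉S               | no ∉e               = contradiction none (>⇒≢ (count-pos (stray? S e) stray))
      where
      stray : Stray S e (u , w)
      stray = (((u<w , f⊆S∪e u∈f , f⊆S∪e w∈f) , lose f∈H (u∈f , w∈f)) , ∉S) , ∉e
    together : ∀ {u w} → u ∈ f → w ∈ f → u ≢ w → (u ∈ S × w ∈ S) ⊎ (u ∈ e × w ∈ e)
    together {u} {w} u∈f w∈f u≢w with <ᶠ-cmp u w
    ... | tri< u<w _ _ = together< u<w u∈f w∈f
    ... | tri≈ _ u≡w _ = contradiction u≡w u≢w
    ... | tri> _ _ w<u = Sum.map swap swap (together< w<u w∈f u∈f)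

  ⊆-edge⇒≡ : ∀ {f e} → f ∈ₗ edges H → e ∈ₗ edges H → f ⊆ e → f ≡ e
  ⊆-edge⇒≡ f∈H e∈H f⊆e = ⊆∧∣p∣≡∣q∣⇒p≡q f⊆e (trans (All.lookup uniform f∈H) (sym (All.lookup uniform e∈H)))

  module Step {S : Subset 8} (c : CrossingEdge H S) where
    open CrossingEdge c public

    meet : ℕ
    meet = ∣ S ∩ edge ∣

    ∣edge∣≡4 : ∣ edge ∣ ≡ 4
    ∣edge∣≡4 = All.lookup uniform edge∈H

    1≤meet : 1 ≤ meet
    1≤meet = Nonempty⇒∣p∣>0 meets

    meet<4 : meet < 4
    meet<4 = subst (meet <_) ∣edge∣≡4 (∣S∩edge∣<∣edge∣ H c)

    ∣S∪edge∣≡grow : ∣ S ∪ edge ∣ ≡ grow ∣ S ∣ meet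
    ∣S∪edge∣≡grow = begin
      ∣ S ∪ edge ∣                ≡⟨ m+n∸n≡m ∣ S ∪ edge ∣ meet ⟨
      ∣ S ∪ edge ∣ + meet ∸ meet  ≡⟨ cong (_∸ meet) (∣p∪q∣+∣p∩q∣≡∣p∣+∣q∣ S edge) ⟩
      ∣ S ∣ + ∣ edge ∣ ∸ meet     ≡⟨ cong (λ k → ∣ S ∣ + k ∸ meet) ∣edge∣≡4 ⟩
      grow ∣ S ∣ meet             ∎
      where open ≡-Reasoning

    ∣S∪edge∣≤∣S∣+3 : ∣ S ∪ edge ∣ ≤ ∣ S ∣ + 3
    ∣S∪edge∣≤∣S∣+3 = ≤-trans (≤-reflexive ∣S∪edge∣≡grow)
                             (≤-trans (∸-monoʳ-≤ (∣ S ∣ + 4) 1≤meet) (≤-reflexive (+-∸-assoc ∣ S ∣ (s≤s z≤n))))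

    completionCost-step : completionCost ∣ S ∣ ≤ gain meet + completionCost ∣ S ∪ edge ∣
    completionCost-step = subst (λ k → completionCost ∣ S ∣ ≤ gain meet + completionCost k) (sym ∣S∪edge∣≡grow)
                          (completionCost-grow (s≤s (∣p∣≤n S)) meet<4 1≤meet)

    adjacentPairs-step : adjacentPairs S + gain meet + strayPairs S edge ≤ adjacentPairs (S ∪ edge)
    adjacentPairs-step = subst (λ k → adjacentPairs S + k + strayPairs S edge ≤ adjacentPairs (S ∪ edge))
                         (trans (newPairs≡ S edge) (cong (λ k → k C 2 ∸ meet C 2) ∣edge∣≡4))
                         (adjacentPairs-∪ S edge∈H)

  completionCost+adjacentPairs≤n₁ : ∀ S → Nonempty S → completionCost ∣ S ∣ + adjacentPairs S ≤ n₁ H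
  completionCost+adjacentPairs≤n₁ S ne = go (8 ∸ ∣ S ∣) S ne ≤-refl
    where
    go : ∀ d S → Nonempty S → 8 ∸ ∣ S ∣ ≤ d → completionCost ∣ S ∣ + adjacentPairs S ≤ n₁ H
    go d S ne deficit with m≤n⇒m<n∨m≡n (∣p∣≤n S)
    go d S ne deficit | inj₂ ∣S∣≡8 =
      subst (λ k → completionCost k + adjacentPairs S ≤ n₁ H) (sym ∣S∣≡8) (adjacentPairs≤n₁ S)
    go zero S ne deficit | inj₁ ∣S∣<8 = contradiction deficit (<⇒≱ (m<n⇒0<n∸m ∣S∣<8))
    go (suc d) S ne@(x , x∈S) deficit | inj₁ ∣S∣<8 = begin
      completionCost ∣ S ∣ + adjacentPairs S                     ≤⟨ +-monoˡ-≤ (adjacentPairs S) completionCost-step ⟩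
      gain meet + completionCost ∣ S ∪ edge ∣ + adjacentPairs S  ≡⟨ shuffle (gain meet) _ _ ⟩
      completionCost ∣ S ∪ edge ∣ + (adjacentPairs S + gain meet) ≤⟨ +-monoʳ-≤ _ (m+n≤o⇒m≤o _ adjacentPairs-step) ⟩
      completionCost ∣ S ∪ edge ∣ + adjacentPairs (S ∪ edge)     ≤⟨ go d (S ∪ edge) (x , p⊆p∪q edge x∈S) deficit′ ⟩
      n₁ H                                                       ∎
      where
      open ≤-Reasoning
      crossing : CrossingEdge H S
      crossing = crossingEdge H connected ne ∣S∣<8
      open Step crossing
      shuffle : ∀ a b c → a + b + c ≡ b + (c + a)
      shuffle = solve-∀
      deficit′ : 8 ∸ ∣ S ∪ edge ∣ ≤ d
      deficit′ = ≤-pred (≤-trans (∸-monoʳ-< (∣S∣<∣S∪edge∣ H crossing) (∣p∣≤n (S ∪ edge))) deficit)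

  module ThreeSteps where
    S₀ : Subset 8
    S₀ = ⁅ zero ⁆

    0∈S₀ : zero ∈ S₀
    0∈S₀ = x∈⁅x⁆ zero

    step₁ : CrossingEdge H S₀
    step₁ = crossingEdge H connected (zero , 0∈S₀) (m<m+n 1 {7} z<s)
    module E₁ = Step step₁
    e₁ S₁ : Subset 8
    e₁ = E₁.edge
    S₁ = S₀ ∪ e₁

    ∣S₁∣≤4 : ∣ S₁ ∣ ≤ 4
    ∣S₁∣≤4 = E₁.∣S∪edge∣≤∣S∣+3

    step₂ : CrossingEdge H S₁
    step₂ = crossingEdge H connected (zero , p⊆p∪q e₁ 0∈S₀) (≤-<-trans ∣S₁∣≤4 (m<m+n 4 {4} z<s))
    module E₂ = Step step₂
    e₂ S₂ : Subset 8
    e₂ = E₂.edge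
    S₂ = S₁ ∪ e₂

    step₃ : CrossingEdge H S₂
    step₃ = crossingEdge H connected (zero , p⊆p∪q e₂ (p⊆p∪q e₁ 0∈S₀))
                         (≤-<-trans (≤-trans E₂.∣S∪edge∣≤∣S∣+3 (+-monoˡ-≤ 3 ∣S₁∣≤4)) (n<1+n 7))
    module E₃ = Step step₃
    e₃ S₃ : Subset 8
    e₃ = E₃.edge
    S₃ = S₂ ∪ e₃

    ∣S₃∣≡grow³ : ∣ S₃ ∣ ≡ grow (grow (grow 1 E₁.meet) E₂.meet) E₃.meet
    ∣S₃∣≡grow³ = begin
      ∣ S₃ ∣                                             ≡⟨ E₃.∣S∪edge∣≡grow ⟩
      grow ∣ S₂ ∣ E₃.meet                                ≡⟨ cong (λ k → grow k E₃.meet) E₂.∣S∪edge∣≡grow ⟩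
      grow (grow ∣ S₁ ∣ E₂.meet) E₃.meet                 ≡⟨ cong (λ k → grow (grow k E₂.meet) E₃.meet) E₁.∣S∪edge∣≡grow ⟩
      grow (grow (grow 1 E₁.meet) E₂.meet) E₃.meet       ∎
      where open ≡-Reasoning

    excess : ℕ
    excess = strayPairs S₁ e₂ + strayPairs S₂ e₃

    cost : ℕ
    cost = threeStepCost E₁.meet E₂.meet E₃.meet

    cost+excess≤n₁ : cost + excess ≤ n₁ H
    cost+excess≤n₁ = begin
      g₁ + g₂ + g₃ + completionCost (grow (grow (grow 1 E₁.meet) E₂.meet) E₃.meet) + (x₂ + x₃)
        ≡⟨ cong (λ k → g₁ + g₂ + g₃ + completionCost k + (x₂ + x₃)) ∣S₃∣≡grow³ ⟨
      g₁ + g₂ + g₃ + completionCost ∣ S₃ ∣ + (x₂ + x₃)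
        ≡⟨ shuffle g₁ g₂ g₃ (completionCost ∣ S₃ ∣) x₂ x₃ ⟩
      completionCost ∣ S₃ ∣ + (g₁ + g₂ + x₂ + g₃ + x₃)
        ≤⟨ +-monoʳ-≤ (completionCost ∣ S₃ ∣) (+-monoˡ-≤ x₃ (+-monoˡ-≤ g₃ (+-monoˡ-≤ x₂ (+-monoˡ-≤ g₂ g₁≤adj₁)))) ⟩
      completionCost ∣ S₃ ∣ + (adjacentPairs S₁ + g₂ + x₂ + g₃ + x₃)
        ≤⟨ +-monoʳ-≤ (completionCost ∣ S₃ ∣) (+-monoˡ-≤ x₃ (+-monoˡ-≤ g₃ E₂.adjacentPairs-step)) ⟩
      completionCost ∣ S₃ ∣ + (adjacentPairs S₂ + g₃ + x₃)
        ≤⟨ +-monoʳ-≤ (completionCost ∣ S₃ ∣) E₃.adjacentPairs-step ⟩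
      completionCost ∣ S₃ ∣ + adjacentPairs S₃
        ≤⟨ completionCost+adjacentPairs≤n₁ S₃ (zero , p⊆p∪q e₃ (p⊆p∪q e₂ (p⊆p∪q e₁ 0∈S₀))) ⟩
      n₁ H ∎
      where
      open ≤-Reasoning
      g₁ g₂ g₃ x₂ x₃ : ℕ
      g₁ = gain E₁.meet
      g₂ = gain E₂.meet
      g₃ = gain E₃.meet
      x₂ = strayPairs S₁ e₂
      x₃ = strayPairs S₂ e₃
      g₁≤adj₁ : g₁ ≤ adjacentPairs S₁
      g₁≤adj₁ = m+n≤o⇒n≤o (adjacentPairs S₀) (m+n≤o⇒m≤o (adjacentPairs S₀ + g₁) E₁.adjacentPairs-step)
      shuffle : ∀ a b c d x y → a + b + c + d + (x + y) ≡ d + (a + b + x + c + y)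
      shuffle = solve-∀

    module Tight (n₁≡15 : n₁ H ≡ 15) where
      bound : 15 ≤ cost × (grow (grow (grow 1 E₁.meet) E₂.meet) E₃.meet < 8 → 16 ≤ cost)
      bound = threeStepCost-bound E₁.meet<4 E₂.meet<4 E₃.meet<4 E₁.1≤meet E₂.1≤meet E₃.1≤meet

      cost+excess≤15 : cost + excess ≤ 15
      cost+excess≤15 = subst (cost + excess ≤_) n₁≡15 cost+excess≤n₁

      excess≡0 : excess ≡ 0
      excess≡0 = n≤0⇒n≡0 (+-cancelˡ-≤ cost excess 0
                   (≤-trans cost+excess≤15 (≤-trans (proj₁ bound) (≤-reflexive (sym (+-identityʳ cost))))))

      S₃≡⊤ : S₃ ≡ ⊤
      S₃≡⊤ = ∣p∣≡n⇒p≡⊤ (≤∧≮⇒≡ (∣p∣≤n S₃) λ ∣S₃∣<8 →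
        <-irrefl refl (≤-trans (proj₂ bound (subst (_< 8) ∣S₃∣≡grow³ ∣S₃∣<8))
                               (≤-trans (m≤m+n cost excess) cost+excess≤15)))

      e₁≡S₁ : e₁ ≡ S₁
      e₁≡S₁ = ⊆∧∣p∣≡∣q∣⇒p≡q (q⊆p∪q S₀ e₁)
                (≤-antisym (p⊆q⇒∣p∣≤∣q∣ (q⊆p∪q S₀ e₁)) (subst (∣ S₁ ∣ ≤_) (sym E₁.∣edge∣≡4) ∣S₁∣≤4))

      edge⊆e₁e₂e₃ : ∀ {f} → f ∈ₗ edges H → f ⊆ e₁ ⊎ f ⊆ e₂ ⊎ f ⊆ e₃
      edge⊆e₁e₂e₃ {f} f∈H =
        Sum.[ Sum.map₂ inj₁ ∘ inside-S₂ , inj₂ ∘ inj₂ ]′ (strayPairs≡0⇒⊆⊎⊆ (m+n≡0⇒n≡0 _ excess≡0) f∈H f⊆S₃)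
        where
        f⊆S₃ : f ⊆ S₃
        f⊆S₃ = subst (f ⊆_) (sym S₃≡⊤) ⊆⊤
        inside-S₂ : f ⊆ S₂ → f ⊆ e₁ ⊎ f ⊆ e₂
        inside-S₂ f⊆S₂ = Sum.map₁ (subst (f ⊆_) (sym e₁≡S₁)) (strayPairs≡0⇒⊆⊎⊆ (m+n≡0⇒m≡0 _ excess≡0) f∈H f⊆S₂)

      edge∈e₁e₂e₃ : ∀ {f} → f ∈ₗ edges H → f ∈ₗ (e₁ ∷ e₂ ∷ e₃ ∷ [])
      edge∈e₁e₂e₃ f∈H = Sum.[ here ∘ ⊆-edge⇒≡ f∈H E₁.edge∈H
                            , Sum.[ there ∘ here ∘ ⊆-edge⇒≡ f∈H E₂.edge∈H
                                  , there ∘ there ∘ here ∘ ⊆-edge⇒≡ f∈H E₃.edge∈H ]′ ]′ (edge⊆e₁e₂e₃ f∈H)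

    e₁e₂e₃-distinct : Unique (e₁ ∷ e₂ ∷ e₃ ∷ [])
    e₁e₂e₃-distinct = (≢-sym e₂≢e₁ ∷ ≢-sym e₃≢e₁ ∷ []) ∷ (≢-sym e₃≢e₂ ∷ []) ∷ [] ∷ []
      where
      e₂≢e₁ : e₂ ≢ e₁
      e₂≢e₁ = edge≢ H step₂ (q⊆p∪q S₀ e₁)
      e₃≢e₁ : e₃ ≢ e₁
      e₃≢e₁ = edge≢ H step₃ (p⊆p∪q e₂ ∘ q⊆p∪q S₀ e₁)
      e₃≢e₂ : e₃ ≢ e₂
      e₃≢e₂ = edge≢ H step₃ (q⊆p∪q S₁ e₂)

    e₁e₂e₃∈H : All (_∈ₗ edges H) (e₁ ∷ e₂ ∷ e₃ ∷ [])
    e₁e₂e₃∈H = E₁.edge∈H ∷ E₂.edge∈H ∷ E₃.edge∈H ∷ []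

mainTheorem9 : (H : Hypergraph 8) → Uniform 4 H → Connected H →
    (15 ≤ n₁ H) × (n₁ H ≡ 15 → numEdges H ≡ 3)
mainTheorem9 H uniform connected = 15≤n₁ , numEdges≡3
  where
  open FourUniform H uniform connected
  open ThreeSteps
  15≤n₁ : 15 ≤ n₁ H
  15≤n₁ = ≤-trans (m≤m+n 15 (adjacentPairs S₀)) (completionCost+adjacentPairs≤n₁ S₀ (zero , 0∈S₀))
  numEdges≡3 : n₁ H ≡ 15 → numEdges H ≡ 3
  numEdges≡3 n₁≡15 = Unique⇒length≡ (distinct H) e₁e₂e₃-distinct (All.tabulate edge∈e₁e₂e₃) e₁e₂e₃∈H
    where open Tight n₁≡15
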